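{- Let $\ell \geq 1$ be an integer. For $0 \leq t \leq \ell$ define $$a_t = 2^{2t}\,\frac{(\ell+t)!}{(2t+1)!\,(\ell-t)!}\,(2\ell+1), \qquad b_t = 2^{2t}\binom{\ell+t}{2t},$$ and for $0 \leq t \leq 2\ell+1$ define $c_t$ by: $c_0 = 1$; $$c_t = \frac{2^{3t-1}}{(2t)!}\,\frac{(\ell+\frac{t}{2})!}{(\ell-\frac{t}{2})!}\,\frac{(2\ell+t-1)!!}{(2\ell-t+1)!!}\,(2\ell+1) \quad \text{for even } t \text{ with } 2 \leq t \leq \ell;$$ $$c_t = \frac{2^{3t-2}}{(2t)!}\,\frac{(\ell+\frac{t-1}{2})!}{(\ell-\frac{t-1}{2})!}\,\frac{(2\ell+t)!!}{(2\ell-t)!!}\,(2\ell+1) \quad \text{for odd } t \text{ with } 1 \leq t \leq \ell;$$ $$c_t = 2^{2t-1}\,\frac{(2\ell+t)!}{(2t)!\,(2\ell+1-t)!}\,(2\ell+1) \quad \text{for } \ell+1 \leq t \leq 2\ell+1.$$ Let $A(k) = \sum_{t=0}^{\ell} a_t k^t$, $B(k) = \sum_{t=0}^{\ell} b_t k^t$, $C(k) = \sum_{t=0}^{2\ell+1} c_t k^t$. Then all $a_t, b_t, c_t$ are strictly positive integers, and the polynomial identities $$k\,A(k)^2 + 1 = (k+1)\,B(k)^2 = C(k)$$ hold.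
   Context: For an odd positive integer $N$, $N!!$ denotes the product of all odd integers from $1$ to $N$ (with $(-1)!! = 1$). -}

module Defs where

open import Data.Nat as ℕ using (ℕ; zero; suc; _∸_; _!; _≤ᵇ_; _%_; _/_; NonZero)
open import Data.Nat.Properties using (_!≢0; m*n≢0)
open import Data.Nat.Combinatorics using (_C_)
open import Data.Integer using (+_)
open import Data.Rational using (ℚ; 0ℚ; 1ℚ; _+_; _*_)
import Data.Rational as Q
open import Data.Bool using (if_then_else_)
open import Data.Product using (Σ; _×_)
open import Relation.Binary.PropositionalEquality using (_≡_)

-- Double factorial: for odd N, N!! = 1 * 3 * ... * N.
-- (Only ever applied to odd arguments below; on even arguments this
-- recursion gives the even double factorial, which is never used.)
_!! : ℕ → ℕ
zero !! = 1
suc zero !! = 1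
suc (suc n) !! = suc (suc n) ℕ.* (n !!)

_!!≢0 : ∀ n → NonZero (n !!)
zero !!≢0 = _
suc zero !!≢0 = _
suc (suc n) !!≢0 = m*n≢0 (suc (suc n)) (n !!) {{_}} {{n !!≢0}}

frac : ℕ → (d : ℕ) → .{{NonZero d}} → ℚ
frac n d = (+ n) Q./ d

ℕ→ℚ : ℕ → ℚ
ℕ→ℚ n = frac n 1

_^ℚ_ : ℚ → ℕ → ℚ
x ^ℚ zero = 1ℚ
x ^ℚ suc n = x * (x ^ℚ n)

sumTo : ℕ → (ℕ → ℚ) → ℚ
sumTo zero f = f 0
sumTo (suc n) f = sumTo n f + f (suc n)

a : ℕ → ℕ → ℚ
a ℓ t = frac (2 ℕ.^ (2 ℕ.* t) ℕ.* (ℓ ℕ.+ t) ! ℕ.* (2 ℕ.* ℓ ℕ.+ 1))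
             ((1 ℕ.+ 2 ℕ.* t) ! ℕ.* (ℓ ∸ t) !)
             {{m*n≢0 _ _ {{(1 ℕ.+ 2 ℕ.* t) !≢0}} {{(ℓ ∸ t) !≢0}}}}

b : ℕ → ℕ → ℚ
b ℓ t = ℕ→ℚ (2 ℕ.^ (2 ℕ.* t) ℕ.* ((ℓ ℕ.+ t) C (2 ℕ.* t)))

cEven : ℕ → ℕ → ℚ
cEven ℓ t = frac (2 ℕ.^ (3 ℕ.* t ∸ 1) ℕ.* (ℓ ℕ.+ t / 2) ! ℕ.* (2 ℕ.* ℓ ℕ.+ t ∸ 1) !! ℕ.* (2 ℕ.* ℓ ℕ.+ 1))
                 ((2 ℕ.* t) ! ℕ.* (ℓ ∸ t / 2) ! ℕ.* (2 ℕ.* ℓ ∸ t ℕ.+ 1) !!)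
                 {{m*n≢0 _ _ {{m*n≢0 _ _ {{(2 ℕ.* t) !≢0}} {{(ℓ ∸ t / 2) !≢0}}}} {{(2 ℕ.* ℓ ∸ t ℕ.+ 1) !!≢0}}}}

cOdd : ℕ → ℕ → ℚ
cOdd ℓ t = frac (2 ℕ.^ (3 ℕ.* t ∸ 2) ℕ.* (ℓ ℕ.+ (t ∸ 1) / 2) ! ℕ.* (2 ℕ.* ℓ ℕ.+ t) !! ℕ.* (2 ℕ.* ℓ ℕ.+ 1))
                ((2 ℕ.* t) ! ℕ.* (ℓ ∸ (t ∸ 1) / 2) ! ℕ.* (2 ℕ.* ℓ ∸ t) !!)
                {{m*n≢0 _ _ {{m*n≢0 _ _ {{(2 ℕ.* t) !≢0}} {{(ℓ ∸ (t ∸ 1) / 2) !≢0}}}} {{(2 ℕ.* ℓ ∸ t) !!≢0}}}}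

cHigh : ℕ → ℕ → ℚ
cHigh ℓ t = frac (2 ℕ.^ (2 ℕ.* t ∸ 1) ℕ.* (2 ℕ.* ℓ ℕ.+ t) ! ℕ.* (2 ℕ.* ℓ ℕ.+ 1))
                 ((2 ℕ.* t) ! ℕ.* (2 ℕ.* ℓ ℕ.+ 1 ∸ t) !)
                 {{m*n≢0 _ _ {{(2 ℕ.* t) !≢0}} {{(2 ℕ.* ℓ ℕ.+ 1 ∸ t) !≢0}}}}

c : ℕ → ℕ → ℚ
c ℓ zero = 1ℚ
c ℓ (suc s) =
  if suc s ≤ᵇ ℓ
  then (if suc s % 2 ℕ.≡ᵇ 0 then cEven ℓ (suc s) else cOdd ℓ (suc s))
  else cHigh ℓ (suc s)

Apoly : ℕ → ℚ → ℚ
Apoly ℓ k = sumTo ℓ (λ t → a ℓ t * (k ^ℚ t))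

Bpoly : ℕ → ℚ → ℚ
Bpoly ℓ k = sumTo ℓ (λ t → b ℓ t * (k ^ℚ t))

Cpoly : ℕ → ℚ → ℚ
Cpoly ℓ k = sumTo (2 ℕ.* ℓ ℕ.+ 1) (λ t → c ℓ t * (k ^ℚ t))

IsPosInt : ℚ → Set
IsPosInt q = Σ ℕ (λ n → (0 ℕ.< n) × (q ≡ ℕ→ℚ n))

-- Write x = 1 + 2k.  Pascal's rule shows that the families 2^(2t) C(n+t, 2t+q) are the
-- coefficients of polynomials P_n(k) obeying the Chebyshev recurrence
-- P_(n+2) + P_n = 2x P_(n+1) (+ a constant).  Since a_t = 2^(2t) (C(ℓ+1+t, 2t+1) + C(ℓ+t, 2t+1))
-- and b_t = 2^(2t) C(ℓ+t, 2t), the polynomials A_ℓ and B_ℓ satisfy this recurrence, hence the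
-- first-order system A_(ℓ+1) = x A_ℓ + (x+1) B_ℓ, B_(ℓ+1) = x B_ℓ + (x-1) A_ℓ, which preserves
-- the Pell form (x+1) B² - (x-1) A² = 2, i.e. (k+1) B² = k A² + 1.  The three formulas for c_t
-- all equal 2^(2t-2) (C(2ℓ+1+t, 2t) + C(2ℓ+t, 2t)) for t ≥ 1, so C = 1 + k Q_(2ℓ+1) where
-- Q_n = Σ_s 2^(2s) (C(n+1+s, 2s+2) + C(n+s, 2s+2)) k^s satisfies the recurrence with constant 2;
-- an induction on the pair (Q_(2ℓ+1), Q_(2ℓ+2)) gives Q_(2ℓ+1) = A_ℓ².  (With k = sinh²θ:
-- A_ℓ = sinh((2ℓ+1)θ)/sinh θ, B_ℓ = cosh((2ℓ+1)θ)/cosh θ, Q_n = sinh²(nθ)/sinh²θ.)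

module Submission where

open import Defs
open import Data.Nat using (ℕ; _≤_; _+_; _*_)
open import Data.Product using (_×_)
open import Data.Rational using (ℚ; 1ℚ) renaming (_+_ to _+ℚ_; _*_ to _*ℚ_)
open import Relation.Binary.PropositionalEquality using (_≡_)

open import Algebra.Bundles using (CommutativeMonoid)
import Algebra.Properties.CommutativeSemigroup as CommutativeSemigroupProperties
open import Data.Bool using (true; false; if_then_else_)
open import Data.Bool.Properties using (T-≡)
import Data.Integer as ℤ
import Data.Integer.Properties as ℤP
open import Data.List using (_∷_; [])
open import Data.Nat using (zero; suc; _<_; _∸_; _^_; _!; _/_; _%_; _≤ᵇ_; _≡ᵇ_; z≤n; s≤s; NonZero)
open import Data.Nat.Combinatorics using (_C_; nCk+nC[k+1]≡[n+1]C[k+1]; nC1≡n; k![n∸k]!∣n!)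
open import Data.Nat.Combinatorics.Specification using (k>n⇒nCk≡0; nCk≡n!/k![n-k]!)
open import Data.Nat.DivMod using (m/n*n≡m; m*n/n≡m; m≡m%n+[m/n]*n; m%n<n)
import Data.Nat.Properties as ℕP
open import Data.Nat.Properties using (_!*_!≢0; m*n≢0)
import Data.Nat.Tactic.RingSolver as ℕ-Solver
open import Data.Product using (_,_; proj₁; proj₂)
open import Data.Rational using (0ℚ; ½; toℚᵘ) renaming (_-_ to _-ℚ_)
import Data.Rational.Properties as QP
open import Data.Rational.Unnormalised as ℚᵘ using (ℚᵘ; mkℚᵘ; *≡*)
import Data.Rational.Unnormalised.Properties as ℚᵘP
open import Function.Bundles using (Equivalence)
open import Level using (0ℓ)
open import Relation.Binary.PropositionalEquality using (refl; cong; cong₂; sym; trans; subst; module ≡-Reasoning)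
open import Relation.Nullary.Decidable using (dec⇒maybe)
open import Tactic.RingSolver using (solve-∀; solve)
open import Tactic.RingSolver.Core.AlmostCommutativeRing using (AlmostCommutativeRing; fromCommutativeRing)

ℚ-ring : AlmostCommutativeRing 0ℓ 0ℓ
ℚ-ring = fromCommutativeRing QP.+-*-commutativeRing (λ x → dec⇒maybe (0ℚ QP.≟ x))

module ℕ+ = CommutativeSemigroupProperties ℕP.+-commutativeSemigroup
module ℚ+ = CommutativeSemigroupProperties (CommutativeMonoid.commutativeSemigroup QP.+-0-commutativeMonoid)
module ℚ* = CommutativeSemigroupProperties (CommutativeMonoid.commutativeSemigroup QP.*-1-commutativeMonoid)

ℕ→ℚᵘ : ℕ → ℚᵘ
ℕ→ℚᵘ n = mkℚᵘ (ℤ.+ n) 0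

ℕ→ℚᵘ-+ : ∀ m n → ℕ→ℚᵘ (m + n) ℚᵘ.≃ ℕ→ℚᵘ m ℚᵘ.+ ℕ→ℚᵘ n
ℕ→ℚᵘ-+ m n = *≡* (cong (ℤ._* ℤ.+ 1) (trans (ℤP.pos-+ m n)
  (sym (cong₂ ℤ._+_ (ℤP.*-identityʳ (ℤ.+ m)) (ℤP.*-identityʳ (ℤ.+ n))))))

ℕ→ℚᵘ-* : ∀ m n → ℕ→ℚᵘ (m * n) ℚᵘ.≃ ℕ→ℚᵘ m ℚᵘ.* ℕ→ℚᵘ n
ℕ→ℚᵘ-* m n = *≡* (cong (ℤ._* ℤ.+ 1) (ℤP.pos-* m n))

toℚᵘ-ℕ→ℚ : ∀ n → toℚᵘ (ℕ→ℚ n) ℚᵘ.≃ ℕ→ℚᵘ n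
toℚᵘ-ℕ→ℚ n = QP.toℚᵘ-fromℚᵘ (ℕ→ℚᵘ n)

ℕ→ℚ-+ : ∀ m n → ℕ→ℚ (m + n) ≡ ℕ→ℚ m +ℚ ℕ→ℚ n
ℕ→ℚ-+ m n = QP.toℚᵘ-injective (begin
  toℚᵘ (ℕ→ℚ (m + n))              ≈⟨ toℚᵘ-ℕ→ℚ (m + n) ⟩
  ℕ→ℚᵘ (m + n)                     ≈⟨ ℕ→ℚᵘ-+ m n ⟩
  ℕ→ℚᵘ m ℚᵘ.+ ℕ→ℚᵘ n              ≈⟨ ℚᵘP.+-cong (toℚᵘ-ℕ→ℚ m) (toℚᵘ-ℕ→ℚ n) ⟨
  toℚᵘ (ℕ→ℚ m) ℚᵘ.+ toℚᵘ (ℕ→ℚ n)  ≈⟨ QP.toℚᵘ-homo-+ (ℕ→ℚ m) (ℕ→ℚ n) ⟨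
  toℚᵘ (ℕ→ℚ m +ℚ ℕ→ℚ n)           ∎)
  where open ℚᵘP.≃-Reasoning

ℕ→ℚ-* : ∀ m n → ℕ→ℚ (m * n) ≡ ℕ→ℚ m *ℚ ℕ→ℚ n
ℕ→ℚ-* m n = QP.toℚᵘ-injective (begin
  toℚᵘ (ℕ→ℚ (m * n))              ≈⟨ toℚᵘ-ℕ→ℚ (m * n) ⟩
  ℕ→ℚᵘ (m * n)                     ≈⟨ ℕ→ℚᵘ-* m n ⟩
  ℕ→ℚᵘ m ℚᵘ.* ℕ→ℚᵘ n              ≈⟨ ℚᵘP.*-cong (toℚᵘ-ℕ→ℚ m) (toℚᵘ-ℕ→ℚ n) ⟨
  toℚᵘ (ℕ→ℚ m) ℚᵘ.* toℚᵘ (ℕ→ℚ n)  ≈⟨ QP.toℚᵘ-homo-* (ℕ→ℚ m) (ℕ→ℚ n) ⟨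
  toℚᵘ (ℕ→ℚ m *ℚ ℕ→ℚ n)           ∎)
  where open ℚᵘP.≃-Reasoning

frac-cong : ∀ {n d n′ d′} .{{_ : NonZero d}} .{{_ : NonZero d′}} →
            n * d′ ≡ n′ * d → frac n d ≡ frac n′ d′
frac-cong {n} {suc d} {n′} {suc d′} eq =
  QP.fromℚᵘ-cong {mkℚᵘ (ℤ.+ n) d} {mkℚᵘ (ℤ.+ n′) d′} (*≡* (begin
    ℤ.+ n ℤ.* ℤ.+ suc d′  ≡⟨ ℤP.pos-* n (suc d′) ⟨
    ℤ.+ (n * suc d′)      ≡⟨ cong ℤ.+_ eq ⟩
    ℤ.+ (n′ * suc d)      ≡⟨ ℤP.pos-* n′ (suc d) ⟩
    ℤ.+ n′ ℤ.* ℤ.+ suc d  ∎))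
  where open ≡-Reasoning

frac≡ℕ→ℚ : ∀ {n d m} .{{_ : NonZero d}} → n ≡ m * d → frac n d ≡ ℕ→ℚ m
frac≡ℕ→ℚ {n} {d} {m} eq = frac-cong {n} {d} {m} {1} (trans (ℕP.*-identityʳ n) eq)

sumTo-cong : ∀ n {f g : ℕ → ℚ} → (∀ t → t ≤ n → f t ≡ g t) → sumTo n f ≡ sumTo n g
sumTo-cong zero    f≗g = f≗g 0 z≤n
sumTo-cong (suc n) f≗g =
  cong₂ _+ℚ_ (sumTo-cong n (λ t t≤n → f≗g t (ℕP.m≤n⇒m≤1+n t≤n))) (f≗g (suc n) ℕP.≤-refl)

sumTo-suc : ∀ n (f : ℕ → ℚ) → sumTo (suc n) f ≡ f 0 +ℚ sumTo n (λ t → f (suc t))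
sumTo-suc zero    f = refl
sumTo-suc (suc n) f = trans (cong (_+ℚ f (2 + n)) (sumTo-suc n f))
  (QP.+-assoc (f 0) (sumTo n (λ t → f (suc t))) (f (2 + n)))

sumTo-+ : ∀ n (f g : ℕ → ℚ) → sumTo n (λ t → f t +ℚ g t) ≡ sumTo n f +ℚ sumTo n g
sumTo-+ zero    f g = refl
sumTo-+ (suc n) f g = trans (cong (_+ℚ (f (suc n) +ℚ g (suc n))) (sumTo-+ n f g))
  (ℚ+.interchange (sumTo n f) (sumTo n g) (f (suc n)) (g (suc n)))

sumTo-*ˡ : ∀ n c (f : ℕ → ℚ) → sumTo n (λ t → c *ℚ f t) ≡ c *ℚ sumTo n f
sumTo-*ˡ zero    c f = refl
sumTo-*ˡ (suc n) c f = trans (cong (_+ℚ c *ℚ f (suc n)) (sumTo-*ˡ n c f))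
  (sym (QP.*-distribˡ-+ c (sumTo n f) (f (suc n))))

eval : ℕ → (ℕ → ℕ) → ℚ → ℚ
eval n f k = sumTo n (λ t → ℕ→ℚ (f t) *ℚ (k ^ℚ t))

eval-cong : ∀ n {f g : ℕ → ℕ} k → (∀ t → f t ≡ g t) → eval n f k ≡ eval n g k
eval-cong n k f≗g = sumTo-cong n (λ t _ → cong (λ c → ℕ→ℚ c *ℚ (k ^ℚ t)) (f≗g t))

eval-suc : ∀ n f k → eval (suc n) f k ≡ ℕ→ℚ (f 0) +ℚ k *ℚ eval n (λ t → f (suc t)) k
eval-suc n f k = begin
  eval (suc n) f k
    ≡⟨ sumTo-suc n (λ t → ℕ→ℚ (f t) *ℚ (k ^ℚ t)) ⟩
  ℕ→ℚ (f 0) *ℚ 1ℚ +ℚ sumTo n (λ t → ℕ→ℚ (f (suc t)) *ℚ (k *ℚ (k ^ℚ t)))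
    ≡⟨ cong₂ _+ℚ_ (QP.*-identityʳ (ℕ→ℚ (f 0)))
             (sumTo-cong n (λ t _ → ℚ*.x∙yz≈y∙xz (ℕ→ℚ (f (suc t))) k (k ^ℚ t))) ⟩
  ℕ→ℚ (f 0) +ℚ sumTo n (λ t → k *ℚ (ℕ→ℚ (f (suc t)) *ℚ (k ^ℚ t)))
    ≡⟨ cong (ℕ→ℚ (f 0) +ℚ_) (sumTo-*ˡ n k (λ t → ℕ→ℚ (f (suc t)) *ℚ (k ^ℚ t))) ⟩
  ℕ→ℚ (f 0) +ℚ k *ℚ eval n (λ t → f (suc t)) k ∎
  where open ≡-Reasoning

eval-+ : ∀ n f g k → eval n (λ t → f t + g t) k ≡ eval n f k +ℚ eval n g k
eval-+ n f g k = trans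
  (sumTo-cong n (λ t _ → trans (cong (_*ℚ (k ^ℚ t)) (ℕ→ℚ-+ (f t) (g t)))
                                 (QP.*-distribʳ-+ (k ^ℚ t) (ℕ→ℚ (f t)) (ℕ→ℚ (g t)))))
  (sumTo-+ n (λ t → ℕ→ℚ (f t) *ℚ (k ^ℚ t)) (λ t → ℕ→ℚ (g t) *ℚ (k ^ℚ t)))

eval-* : ∀ n c f k → eval n (λ t → c * f t) k ≡ ℕ→ℚ c *ℚ eval n f k
eval-* n c f k = trans
  (sumTo-cong n (λ t _ → trans (cong (_*ℚ (k ^ℚ t)) (ℕ→ℚ-* c (f t)))
                                 (QP.*-assoc (ℕ→ℚ c) (ℕ→ℚ (f t)) (k ^ℚ t))))
  (sumTo-*ˡ n (ℕ→ℚ c) (λ t → ℕ→ℚ (f t) *ℚ (k ^ℚ t)))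

eval-extend : ∀ j n f k → (∀ t → n < t → f t ≡ 0) → eval (j + n) f k ≡ eval n f k
eval-extend zero    n f k f>n≡0 = refl
eval-extend (suc j) n f k f>n≡0 = begin
  eval (j + n) f k +ℚ ℕ→ℚ (f (suc (j + n))) *ℚ (k ^ℚ suc (j + n))
    ≡⟨ cong (λ c → eval (j + n) f k +ℚ ℕ→ℚ c *ℚ (k ^ℚ suc (j + n)))
            (f>n≡0 (suc (j + n)) (s≤s (ℕP.m≤n+m n j))) ⟩
  eval (j + n) f k +ℚ 0ℚ *ℚ (k ^ℚ suc (j + n))
    ≡⟨ cong (eval (j + n) f k +ℚ_) (QP.*-zeroˡ (k ^ℚ suc (j + n))) ⟩
  eval (j + n) f k +ℚ 0ℚ
    ≡⟨ QP.+-identityʳ (eval (j + n) f k) ⟩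
  eval (j + n) f k
    ≡⟨ eval-extend j n f k f>n≡0 ⟩
  eval n f k ∎
  where open ≡-Reasoning

ChebyshevRecurrence : ℚ → ℚ → (ℕ → ℚ) → Set
ChebyshevRecurrence x c X = ∀ n → X (2 + n) +ℚ X n ≡ ℕ→ℚ 2 *ℚ x *ℚ X (1 + n) +ℚ c

record ChebyshevCoefficients (d : ℕ) (F : ℕ → ℕ → ℕ) : Set where
  field
    constant : ∀ n → F (2 + n) 0 + F n 0 ≡ 2 * F (1 + n) 0 + d
    higher   : ∀ n s → F (2 + n) (suc s) + F n (suc s) ≡ 2 * F (1 + n) (suc s) + 4 * F (1 + n) s

eval-chebyshev : ∀ {d F} → ChebyshevCoefficients d F → (∀ n t → n < t → F n t ≡ 0) →
                 ∀ k → ChebyshevRecurrence (1ℚ +ℚ ℕ→ℚ 2 *ℚ k) (ℕ→ℚ d) (λ n → eval n (F n) k)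
eval-chebyshev {d} {F} coeffs degree k n = begin
  eval (2 + n) (F (2 + n)) k +ℚ eval n (F n) k
    ≡⟨ cong (eval (2 + n) (F (2 + n)) k +ℚ_) (eval-extend 2 n (F n) k (degree n)) ⟨
  eval (2 + n) (F (2 + n)) k +ℚ eval (2 + n) (F n) k
    ≡⟨ eval-+ (2 + n) (F (2 + n)) (F n) k ⟨
  eval (2 + n) (λ t → F (2 + n) t + F n t) k
    ≡⟨ eval-cong (2 + n) k recurrence ⟩
  eval (2 + n) (λ t → 2 * G t + lower t) k
    ≡⟨ eval-+ (2 + n) (λ t → 2 * G t) lower k ⟩
  eval (2 + n) (λ t → 2 * G t) k +ℚ eval (2 + n) lower k
    ≡⟨ cong₂ _+ℚ_ (eval-* (2 + n) 2 G k) (eval-suc (1 + n) lower k) ⟩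
  ℕ→ℚ 2 *ℚ eval (2 + n) G k +ℚ (ℕ→ℚ d +ℚ k *ℚ eval (1 + n) (λ s → 4 * G s) k)
    ≡⟨ cong₂ (λ u v → ℕ→ℚ 2 *ℚ u +ℚ (ℕ→ℚ d +ℚ k *ℚ v))
             (eval-extend 1 (1 + n) G k (degree (1 + n))) (eval-* (1 + n) 4 G k) ⟩
  ℕ→ℚ 2 *ℚ P +ℚ (ℕ→ℚ d +ℚ k *ℚ (ℕ→ℚ 4 *ℚ P))
    ≡⟨ collect k P (ℕ→ℚ d) ⟩
  ℕ→ℚ 2 *ℚ (1ℚ +ℚ ℕ→ℚ 2 *ℚ k) *ℚ P +ℚ ℕ→ℚ d ∎
  where
  open ≡-Reasoning
  open ChebyshevCoefficients coeffs
  G : ℕ → ℕ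
  G = F (1 + n)
  P : ℚ
  P = eval (1 + n) G k
  lower : ℕ → ℕ
  lower zero    = d
  lower (suc s) = 4 * G s
  recurrence : ∀ t → F (2 + n) t + F n t ≡ 2 * G t + lower t
  recurrence zero    = constant n
  recurrence (suc s) = higher n s
  collect : ∀ k p c →
            ℕ→ℚ 2 *ℚ p +ℚ (c +ℚ k *ℚ (ℕ→ℚ 4 *ℚ p)) ≡ ℕ→ℚ 2 *ℚ (1ℚ +ℚ ℕ→ℚ 2 *ℚ k) *ℚ p +ℚ c
  collect = solve-∀ ℚ-ring

chebyshev-pair : ∀ {d F} → ChebyshevCoefficients d F →
                 ChebyshevCoefficients (d + d) (λ n t → F (suc n) t + F n t)
chebyshev-pair {d} {F} coeffs = record
  { constant = relation-pair (λ m → F (2 + m) 0) (λ m → F m 0) (λ m → F (1 + m) 0) (λ _ → d) constant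
  ; higher   = λ n s → trans
      (relation-pair (λ m → F (2 + m) (suc s)) (λ m → F m (suc s)) (λ m → F (1 + m) (suc s))
                     (λ m → 4 * F (1 + m) s) (λ m → higher m s) n)
      (cong (2 * (F (2 + n) (suc s) + F (1 + n) (suc s)) +_)
            (sym (ℕP.*-distribˡ-+ 4 (F (2 + n) s) (F (1 + n) s))))
  }
  where
  open ChebyshevCoefficients coeffs
  relation-pair : ∀ (a b c e : ℕ → ℕ) → (∀ m → a m + b m ≡ 2 * c m + e m) →
                  ∀ m → (a (suc m) + a m) + (b (suc m) + b m) ≡ 2 * (c (suc m) + c m) + (e (suc m) + e m)
  relation-pair a b c e rel m = begin
    (a (suc m) + a m) + (b (suc m) + b m)            ≡⟨ ℕ+.interchange (a (suc m)) (a m) (b (suc m)) (b m) ⟩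
    (a (suc m) + b (suc m)) + (a m + b m)            ≡⟨ cong₂ _+_ (rel (suc m)) (rel m) ⟩
    (2 * c (suc m) + e (suc m)) + (2 * c m + e m)    ≡⟨ ℕ+.interchange (2 * c (suc m)) (e (suc m)) (2 * c m) (e m) ⟩
    (2 * c (suc m) + 2 * c m) + (e (suc m) + e m)    ≡⟨ cong (_+ (e (suc m) + e m)) (ℕP.*-distribˡ-+ 2 (c (suc m)) (c m)) ⟨
    2 * (c (suc m) + c m) + (e (suc m) + e m)        ∎
    where open ≡-Reasoning

a+b≡c⇒a≡c-b : ∀ {a b c} → a +ℚ b ≡ c → a ≡ c -ℚ b
a+b≡c⇒a≡c-b {a} {b} eq = trans (sym (cancel a b)) (cong (_-ℚ b) eq)
  where
  cancel : ∀ a b → a +ℚ b -ℚ b ≡ a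
  cancel = solve-∀ ℚ-ring

module ChebyshevPell
  (x : ℚ) (A B Q : ℕ → ℚ)
  (A-rec : ChebyshevRecurrence x 0ℚ A) (B-rec : ChebyshevRecurrence x 0ℚ B)
  (Q-rec : ChebyshevRecurrence x (ℕ→ℚ 2) Q)
  (A₀ : A 0 ≡ 1ℚ) (A₁ : A 1 ≡ ℕ→ℚ 2 *ℚ x +ℚ 1ℚ)
  (B₀ : B 0 ≡ 1ℚ) (B₁ : B 1 ≡ ℕ→ℚ 2 *ℚ x -ℚ 1ℚ)
  (Q₁ : Q 1 ≡ 1ℚ) (Q₂ : Q 2 ≡ ℕ→ℚ 2 *ℚ x +ℚ ℕ→ℚ 2)
  where

  open ≡-Reasoning

  next : ∀ {c} X → ChebyshevRecurrence x c X → ∀ n → X (2 + n) ≡ ℕ→ℚ 2 *ℚ x *ℚ X (1 + n) +ℚ c -ℚ X n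
  next X rec n = a+b≡c⇒a≡c-b (rec n)

  -- The steps below take the rotated values as variables subject to these equations; matching the
  -- equations against refl hands the ring solver the expanded terms.
  RotationA RotationB : ℚ → ℚ → ℚ → Set
  RotationA a b a′ = a′ ≡ x *ℚ a +ℚ (x +ℚ 1ℚ) *ℚ b
  RotationB a b b′ = b′ ≡ x *ℚ b +ℚ (x -ℚ 1ℚ) *ℚ a

  rotation : ∀ n → RotationA (A n) (B n) (A (suc n)) × RotationB (A n) (B n) (B (suc n))
  rotation zero rewrite A₀ | B₀ = trans A₁ (solve (x ∷ []) ℚ-ring) , trans B₁ (solve (x ∷ []) ℚ-ring)
  rotation (suc n) with rotation n
  ... | rotA , rotB = trans (next A A-rec n) (stepA (A n) (B n) (A (1 + n)) (B (1 + n)) rotA rotB)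
                    , trans (next B B-rec n) (stepB (A n) (B n) (A (1 + n)) (B (1 + n)) rotA rotB)
    where
    stepA : ∀ a b a′ b′ → RotationA a b a′ → RotationB a b b′ →
            ℕ→ℚ 2 *ℚ x *ℚ a′ +ℚ 0ℚ -ℚ a ≡ x *ℚ a′ +ℚ (x +ℚ 1ℚ) *ℚ b′
    stepA a b _ _ refl refl = solve (x ∷ a ∷ b ∷ []) ℚ-ring
    stepB : ∀ a b a′ b′ → RotationA a b a′ → RotationB a b b′ →
            ℕ→ℚ 2 *ℚ x *ℚ b′ +ℚ 0ℚ -ℚ b ≡ x *ℚ b′ +ℚ (x -ℚ 1ℚ) *ℚ a′
    stepB a b _ _ refl refl = solve (x ∷ a ∷ b ∷ []) ℚ-ring

  pell : ∀ n → ((x +ℚ 1ℚ) *ℚ (B n *ℚ B n) -ℚ (x -ℚ 1ℚ) *ℚ (A n *ℚ A n)) ≡ ℕ→ℚ 2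
  pell zero rewrite A₀ | B₀ = solve (x ∷ []) ℚ-ring
  pell (suc n) with rotation n
  ... | rotA , rotB = trans (invariant (A n) (B n) (A (1 + n)) (B (1 + n)) rotA rotB) (pell n)
    where
    invariant : ∀ a b a′ b′ → RotationA a b a′ → RotationB a b b′ →
                (x +ℚ 1ℚ) *ℚ (b′ *ℚ b′) -ℚ (x -ℚ 1ℚ) *ℚ (a′ *ℚ a′) ≡ (x +ℚ 1ℚ) *ℚ (b *ℚ b) -ℚ (x -ℚ 1ℚ) *ℚ (a *ℚ a)
    invariant a b _ _ refl refl = solve (x ∷ a ∷ b ∷ []) ℚ-ring

  -- In both steps the constant 2 of the Q-recurrence is traded for the Pell form, after which the
  -- step is a polynomial identity.
  Q-odd-step : ∀ n → RotationA (A n) (B n) (A (1 + n)) → Q (1 + 2 * n) ≡ A n *ℚ A n →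
               Q (2 + 2 * n) ≡ ½ *ℚ ((x +ℚ 1ℚ) *ℚ ((A n +ℚ B n) *ℚ (A n +ℚ B n))) →
               Q (3 + 2 * n) ≡ A (1 + n) *ℚ A (1 + n)
  Q-odd-step n rotA odd even = begin
    Q (3 + 2 * n)
      ≡⟨ next Q Q-rec (1 + 2 * n) ⟩
    ℕ→ℚ 2 *ℚ x *ℚ Q (2 + 2 * n) +ℚ ℕ→ℚ 2 -ℚ Q (1 + 2 * n)
      ≡⟨ cong (λ c → ℕ→ℚ 2 *ℚ x *ℚ Q (2 + 2 * n) +ℚ c -ℚ Q (1 + 2 * n)) (pell n) ⟨
    ℕ→ℚ 2 *ℚ x *ℚ Q (2 + 2 * n) +ℚ ((x +ℚ 1ℚ) *ℚ (B n *ℚ B n) -ℚ (x -ℚ 1ℚ) *ℚ (A n *ℚ A n)) -ℚ Q (1 + 2 * n)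
      ≡⟨ step (A n) (B n) (A (1 + n)) (Q (1 + 2 * n)) (Q (2 + 2 * n)) rotA odd even ⟩
    A (1 + n) *ℚ A (1 + n) ∎
    where
    step : ∀ a b a′ q₁ q₂ → RotationA a b a′ → q₁ ≡ a *ℚ a →
           q₂ ≡ ½ *ℚ ((x +ℚ 1ℚ) *ℚ ((a +ℚ b) *ℚ (a +ℚ b))) →
           ℕ→ℚ 2 *ℚ x *ℚ q₂ +ℚ ((x +ℚ 1ℚ) *ℚ (b *ℚ b) -ℚ (x -ℚ 1ℚ) *ℚ (a *ℚ a)) -ℚ q₁ ≡ a′ *ℚ a′
    step a b _ _ _ refl refl refl = solve (x ∷ a ∷ b ∷ []) ℚ-ring

  Q-even-step : ∀ n → RotationA (A n) (B n) (A (1 + n)) → RotationB (A n) (B n) (B (1 + n)) →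
                Q (2 + 2 * n) ≡ ½ *ℚ ((x +ℚ 1ℚ) *ℚ ((A n +ℚ B n) *ℚ (A n +ℚ B n))) →
                Q (3 + 2 * n) ≡ A (1 + n) *ℚ A (1 + n) →
                Q (4 + 2 * n) ≡ ½ *ℚ ((x +ℚ 1ℚ) *ℚ ((A (1 + n) +ℚ B (1 + n)) *ℚ (A (1 + n) +ℚ B (1 + n))))
  Q-even-step n rotA rotB even odd = begin
    Q (4 + 2 * n)
      ≡⟨ next Q Q-rec (2 + 2 * n) ⟩
    ℕ→ℚ 2 *ℚ x *ℚ Q (3 + 2 * n) +ℚ ℕ→ℚ 2 -ℚ Q (2 + 2 * n)
      ≡⟨ cong (λ c → ℕ→ℚ 2 *ℚ x *ℚ Q (3 + 2 * n) +ℚ c -ℚ Q (2 + 2 * n)) (pell n) ⟨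
    ℕ→ℚ 2 *ℚ x *ℚ Q (3 + 2 * n) +ℚ ((x +ℚ 1ℚ) *ℚ (B n *ℚ B n) -ℚ (x -ℚ 1ℚ) *ℚ (A n *ℚ A n)) -ℚ Q (2 + 2 * n)
      ≡⟨ step (A n) (B n) (A (1 + n)) (B (1 + n)) (Q (2 + 2 * n)) (Q (3 + 2 * n)) rotA rotB even odd ⟩
    ½ *ℚ ((x +ℚ 1ℚ) *ℚ ((A (1 + n) +ℚ B (1 + n)) *ℚ (A (1 + n) +ℚ B (1 + n)))) ∎
    where
    step : ∀ a b a′ b′ q₂ q₃ → RotationA a b a′ → RotationB a b b′ →
           q₂ ≡ ½ *ℚ ((x +ℚ 1ℚ) *ℚ ((a +ℚ b) *ℚ (a +ℚ b))) → q₃ ≡ a′ *ℚ a′ →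
           ℕ→ℚ 2 *ℚ x *ℚ q₃ +ℚ ((x +ℚ 1ℚ) *ℚ (b *ℚ b) -ℚ (x -ℚ 1ℚ) *ℚ (a *ℚ a)) -ℚ q₂
             ≡ ½ *ℚ ((x +ℚ 1ℚ) *ℚ ((a′ +ℚ b′) *ℚ (a′ +ℚ b′)))
    step a b _ _ _ _ refl refl refl refl = solve (x ∷ a ∷ b ∷ []) ℚ-ring

  Q-odd-even : ∀ n → Q (1 + 2 * n) ≡ A n *ℚ A n
                   × Q (2 + 2 * n) ≡ ½ *ℚ ((x +ℚ 1ℚ) *ℚ ((A n +ℚ B n) *ℚ (A n +ℚ B n)))
  Q-odd-even zero rewrite A₀ | B₀ = trans Q₁ (sym (QP.*-identityˡ 1ℚ)) , trans Q₂ (solve (x ∷ []) ℚ-ring)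
  Q-odd-even (suc n) with rotation n | Q-odd-even n
  ... | rotA , rotB | odd , even =
    trans (cong Q (oddIndex n)) odd′ , trans (cong Q (evenIndex n)) (Q-even-step n rotA rotB even odd′)
    where
    odd′ : Q (3 + 2 * n) ≡ A (1 + n) *ℚ A (1 + n)
    odd′ = Q-odd-step n rotA odd even
    oddIndex : ∀ n → 1 + 2 * suc n ≡ 3 + 2 * n
    oddIndex = ℕ-Solver.solve-∀
    evenIndex : ∀ n → 2 + 2 * suc n ≡ 4 + 2 * n
    evenIndex = ℕ-Solver.solve-∀

nCk>0 : ∀ {n k} → k ≤ n → 0 < n C k
nCk>0 {n}     {zero}  _         = s≤s z≤n
nCk>0 {suc n} {suc k} (s≤s k≤n) =
  subst (0 <_) (nCk+nC[k+1]≡[n+1]C[k+1] n k) (ℕP.<-≤-trans (nCk>0 k≤n) (ℕP.m≤m+n _ _))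

[2+n]C[2+k]+nC[2+k]≡2*[1+n]C[2+k]+nCk : ∀ n k →
  (2 + n) C (2 + k) + n C (2 + k) ≡ 2 * ((1 + n) C (2 + k)) + n C k
[2+n]C[2+k]+nC[2+k]≡2*[1+n]C[2+k]+nCk n k = begin
  (2 + n) C (2 + k) + n C (2 + k)
    ≡⟨ cong (_+ n C (2 + k)) (nCk+nC[k+1]≡[n+1]C[k+1] (1 + n) (1 + k)) ⟨
  ((1 + n) C (1 + k) + (1 + n) C (2 + k)) + n C (2 + k)
    ≡⟨ cong (λ c → (c + (1 + n) C (2 + k)) + n C (2 + k)) (nCk+nC[k+1]≡[n+1]C[k+1] n k) ⟨
  ((n C k + n C (1 + k)) + (1 + n) C (2 + k)) + n C (2 + k)
    ≡⟨ regroup (n C k) (n C (1 + k)) ((1 + n) C (2 + k)) (n C (2 + k)) ⟩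
  (1 + n) C (2 + k) + (n C (1 + k) + n C (2 + k)) + n C k
    ≡⟨ cong (λ c → (1 + n) C (2 + k) + c + n C k) (nCk+nC[k+1]≡[n+1]C[k+1] n (1 + k)) ⟩
  (1 + n) C (2 + k) + (1 + n) C (2 + k) + n C k
    ≡⟨ cong (λ c → (1 + n) C (2 + k) + c + n C k) (ℕP.+-identityʳ ((1 + n) C (2 + k))) ⟨
  2 * ((1 + n) C (2 + k)) + n C k ∎
  where
  open ≡-Reasoning
  regroup : ∀ a b c d → ((a + b) + c) + d ≡ c + (b + d) + a
  regroup = ℕ-Solver.solve-∀

-- a_t = mvPair 1 ℓ t, b_t = mvCoeff 0 ℓ t and c_(s+1) = mvPair 2 (2ℓ+1) s.  For q = 0, 1 the
-- polynomials Σ_t mvCoeff q n t k^t are Morgan–Voyce polynomials evaluated at 4k.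
mvCoeff : ℕ → ℕ → ℕ → ℕ
mvCoeff q n t = 2 ^ (2 * t) * ((n + t) C (q + 2 * t))

mvPair : ℕ → ℕ → ℕ → ℕ
mvPair q n t = mvCoeff q (suc n) t + mvCoeff q n t

mvCoeff-zero : ∀ q n → mvCoeff q n 0 ≡ n C q
mvCoeff-zero q n = trans (ℕP.*-identityˡ _) (cong₂ _C_ (ℕP.+-identityʳ n) (ℕP.+-identityʳ q))

mvCoeff-suc : ∀ q n s → mvCoeff q n (suc s) ≡ 4 * 2 ^ (2 * s) * (suc (n + s) C (2 + (q + 2 * s)))
mvCoeff-suc q n s = cong₂ _*_
  (trans (cong (2 ^_) (ℕP.*-suc 2 s)) (sym (ℕP.*-assoc 2 2 (2 ^ (2 * s)))))
  (cong₂ _C_ (ℕP.+-suc n s) (index q s))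
  where
  index : ∀ q s → q + 2 * suc s ≡ 2 + (q + 2 * s)
  index = ℕ-Solver.solve-∀

mvCoeff-higher : ∀ q n s →
  mvCoeff q (2 + n) (suc s) + mvCoeff q n (suc s) ≡ 2 * mvCoeff q (1 + n) (suc s) + 4 * mvCoeff q (1 + n) s
mvCoeff-higher q n s = begin
  mvCoeff q (2 + n) (suc s) + mvCoeff q n (suc s)
    ≡⟨ cong₂ _+_ (mvCoeff-suc q (2 + n) s) (mvCoeff-suc q n s) ⟩
  4 * P * ((2 + M) C (2 + K)) + 4 * P * (M C (2 + K))
    ≡⟨ ℕP.*-distribˡ-+ (4 * P) _ _ ⟨
  4 * P * ((2 + M) C (2 + K) + M C (2 + K))
    ≡⟨ cong (4 * P *_) ([2+n]C[2+k]+nC[2+k]≡2*[1+n]C[2+k]+nCk M K) ⟩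
  4 * P * (2 * ((1 + M) C (2 + K)) + M C K)
    ≡⟨ distribute P ((1 + M) C (2 + K)) (M C K) ⟩
  2 * (4 * P * ((1 + M) C (2 + K))) + 4 * (P * (M C K))
    ≡⟨ cong (λ c → 2 * c + 4 * (P * (M C K))) (mvCoeff-suc q (1 + n) s) ⟨
  2 * mvCoeff q (1 + n) (suc s) + 4 * mvCoeff q (1 + n) s ∎
  where
  open ≡-Reasoning
  P M K : ℕ
  P = 2 ^ (2 * s)
  M = suc (n + s)
  K = q + 2 * s
  distribute : ∀ p x y → 4 * p * (2 * x + y) ≡ 2 * (4 * p * x) + 4 * (p * y)
  distribute = ℕ-Solver.solve-∀

mvCoeff-vanishes : ∀ q n t → n < q + t → mvCoeff q n t ≡ 0
mvCoeff-vanishes q n t n<q+t = trans (cong (2 ^ (2 * t) *_) (k>n⇒nCk≡0 n+t<q+2t)) (ℕP.*-zeroʳ (2 ^ (2 * t)))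
  where
  n+t<q+2t : n + t < q + 2 * t
  n+t<q+2t = subst (n + t <_) (shuffle q t) (ℕP.+-monoˡ-< t n<q+t)
    where
    shuffle : ∀ q t → q + t + t ≡ q + 2 * t
    shuffle = ℕ-Solver.solve-∀

mvCoeff-pos : ∀ q n t → q + t ≤ n → 0 < mvCoeff q n t
mvCoeff-pos q n t q+t≤n = ℕP.*-mono-≤ (ℕP.m^n>0 2 (2 * t)) (nCk>0 q+2t≤n+t)
  where
  q+2t≤n+t : q + 2 * t ≤ n + t
  q+2t≤n+t = subst (_≤ n + t) (shuffle q t) (ℕP.+-monoˡ-≤ t q+t≤n)
    where
    shuffle : ∀ q t → q + t + t ≡ q + 2 * t
    shuffle = ℕ-Solver.solve-∀

mvPair-vanishes : ∀ q n t → suc n < q + t → mvPair q n t ≡ 0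
mvPair-vanishes q n t 1+n<q+t = cong₂ _+_
  (mvCoeff-vanishes q (suc n) t 1+n<q+t) (mvCoeff-vanishes q n t (ℕP.<-trans (ℕP.n<1+n n) 1+n<q+t))

mvPair-pos : ∀ q n t → q + t ≤ suc n → 0 < mvPair q n t
mvPair-pos q n t q+t≤1+n = ℕP.<-≤-trans (mvCoeff-pos q (suc n) t q+t≤1+n) (ℕP.m≤m+n _ _)

mvCoeff₀-chebyshev : ChebyshevCoefficients 0 (mvCoeff 0)
mvCoeff₀-chebyshev = record { constant = λ n → refl ; higher = mvCoeff-higher 0 }

mvCoeff₁-chebyshev : ChebyshevCoefficients 0 (mvCoeff 1)
mvCoeff₁-chebyshev = record { constant = constant ; higher = mvCoeff-higher 1 }
  where
  open ≡-Reasoning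
  constant : ∀ n → mvCoeff 1 (2 + n) 0 + mvCoeff 1 n 0 ≡ 2 * mvCoeff 1 (1 + n) 0 + 0
  constant n = begin
    mvCoeff 1 (2 + n) 0 + mvCoeff 1 n 0 ≡⟨ cong₂ _+_ (mvCoeff-zero 1 (2 + n)) (mvCoeff-zero 1 n) ⟩
    (2 + n) C 1 + n C 1                 ≡⟨ cong₂ _+_ (nC1≡n (2 + n)) (nC1≡n n) ⟩
    (2 + n) + n                         ≡⟨ second-difference n ⟩
    2 * (1 + n) + 0                     ≡⟨ cong (λ c → 2 * c + 0) (trans (mvCoeff-zero 1 (1 + n)) (nC1≡n (1 + n))) ⟨
    2 * mvCoeff 1 (1 + n) 0 + 0         ∎
    where
    second-difference : ∀ n → (2 + n) + n ≡ 2 * (1 + n) + 0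
    second-difference = ℕ-Solver.solve-∀

mvCoeff₂-chebyshev : ChebyshevCoefficients 1 (mvCoeff 2)
mvCoeff₂-chebyshev = record { constant = constant ; higher = mvCoeff-higher 2 }
  where
  constant : ∀ n → mvCoeff 2 (2 + n) 0 + mvCoeff 2 n 0 ≡ 2 * mvCoeff 2 (1 + n) 0 + 1
  constant n rewrite mvCoeff-zero 2 (2 + n) | mvCoeff-zero 2 n | mvCoeff-zero 2 (1 + n) =
    [2+n]C[2+k]+nC[2+k]≡2*[1+n]C[2+k]+nCk n 0

m+n≡o⇒o∸m≡n : ∀ {m n o} → m + n ≡ o → o ∸ m ≡ n
m+n≡o⇒o∸m≡n {m} {n} refl = ℕP.m+n∸m≡n m n

nCk*[k!*[n∸k]!]≡n! : ∀ {n k} → k ≤ n → (n C k) * (k ! * (n ∸ k) !) ≡ n !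
nCk*[k!*[n∸k]!]≡n! {n} {k} k≤n = trans (cong (_* (k ! * (n ∸ k) !)) (nCk≡n!/k![n-k]! k≤n))
                                      (m/n*n≡m {{k !* (n ∸ k) !≢0}} (k![n∸k]!∣n! k≤n))

[m+d]Cm*[m!*d!]≡[m+d]! : ∀ m d → ((m + d) C m) * (m ! * d !) ≡ (m + d) !
[m+d]Cm*[m!*d!]≡[m+d]! m d = trans (cong (λ e → ((m + d) C m) * (m ! * e !)) (sym (ℕP.m+n∸m≡n m d)))
                                   (nCk*[k!*[n∸k]!]≡n! (ℕP.m≤m+n m d))

[m+d]C[1+m]*[[1+m]!*d!]≡d*[m+d]! : ∀ m d → ((m + d) C suc m) * (suc m ! * d !) ≡ d * (m + d) !
[m+d]C[1+m]*[[1+m]!*d!]≡d*[m+d]! m zero =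
  cong (_* (suc m ! * 1)) (k>n⇒nCk≡0 (s≤s (ℕP.≤-reflexive (ℕP.+-identityʳ m))))
[m+d]C[1+m]*[[1+m]!*d!]≡d*[m+d]! m (suc e) = begin
  ((m + suc e) C suc m) * (suc m ! * (suc e * e !))
    ≡⟨ cong (λ n → (n C suc m) * (suc m ! * (suc e * e !))) (ℕP.+-suc m e) ⟩
  ((suc m + e) C suc m) * (suc m ! * (suc e * e !))   ≡⟨ pull-out ((suc m + e) C suc m) (suc m !) (suc e) (e !) ⟩
  suc e * (((suc m + e) C suc m) * (suc m ! * e !))   ≡⟨ cong (suc e *_) ([m+d]Cm*[m!*d!]≡[m+d]! (suc m) e) ⟩
  suc e * (suc m + e) !                             ≡⟨ cong (λ n → suc e * n !) (ℕP.+-suc m e) ⟨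
  suc e * (m + suc e) !                             ∎
  where
  open ≡-Reasoning
  pull-out : ∀ c f s g → c * (f * (s * g)) ≡ s * (c * (f * g))
  pull-out = ℕ-Solver.solve-∀

binomialPair-factorial : ∀ m d →
  ((suc m + d) C suc m + (m + d) C suc m) * (suc m ! * d !) ≡ (m + d) ! * (suc m + 2 * d)
binomialPair-factorial m d = begin
  ((suc m + d) C suc m + (m + d) C suc m) * (suc m ! * d !)
    ≡⟨ ℕP.*-distribʳ-+ (suc m ! * d !) ((suc m + d) C suc m) ((m + d) C suc m) ⟩
  ((suc m + d) C suc m) * (suc m ! * d !) + ((m + d) C suc m) * (suc m ! * d !)
    ≡⟨ cong₂ _+_ ([m+d]Cm*[m!*d!]≡[m+d]! (suc m) d) ([m+d]C[1+m]*[[1+m]!*d!]≡d*[m+d]! m d) ⟩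
  suc (m + d) * (m + d) ! + d * (m + d) !
    ≡⟨ collect m d ((m + d) !) ⟩
  (m + d) ! * (suc m + 2 * d) ∎
  where
  open ≡-Reasoning
  collect : ∀ m d f → suc (m + d) * f + d * f ≡ f * (suc m + 2 * d)
  collect = ℕ-Solver.solve-∀

mvPair-factorial : ∀ q n t m d → q + 2 * t ≡ suc m → n + t ≡ m + d →
  mvPair q n t * (suc m ! * d !) ≡ 2 ^ (2 * t) * ((m + d) ! * (suc m + 2 * d))
mvPair-factorial q n t m d q+2t≡1+m n+t≡m+d = begin
  (P * (suc (n + t) C (q + 2 * t)) + P * ((n + t) C (q + 2 * t))) * X
    ≡⟨ cong₂ (λ u v → (P * (suc u C v) + P * (u C v)) * X) n+t≡m+d q+2t≡1+m ⟩
  (P * ((suc m + d) C suc m) + P * ((m + d) C suc m)) * X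
    ≡⟨ factor P ((suc m + d) C suc m) ((m + d) C suc m) X ⟩
  P * (((suc m + d) C suc m + (m + d) C suc m) * X)
    ≡⟨ cong (P *_) (binomialPair-factorial m d) ⟩
  P * ((m + d) ! * (suc m + 2 * d)) ∎
  where
  open ≡-Reasoning
  P X : ℕ
  P = 2 ^ (2 * t)
  X = suc m ! * d !
  factor : ∀ p a b x → (p * a + p * b) * x ≡ p * ((a + b) * x)
  factor = ℕ-Solver.solve-∀

n!≡n!!*[n∸1]!! : ∀ n → n ! ≡ n !! * (n ∸ 1) !!
n!≡n!!*[n∸1]!! zero          = refl
n!≡n!!*[n∸1]!! (suc zero)    = refl
n!≡n!!*[n∸1]!! (suc (suc n)) = begin
  suc (suc n) * suc n !                ≡⟨ cong (suc (suc n) *_) (n!≡n!!*[n∸1]!! (suc n)) ⟩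
  suc (suc n) * (suc n !! * n !!)      ≡⟨ swap (suc (suc n)) (suc n !!) (n !!) ⟩
  suc (suc n) * n !! * suc n !!        ∎
  where
  open ≡-Reasoning
  swap : ∀ a b c → a * (b * c) ≡ a * c * b
  swap = ℕ-Solver.solve-∀

[2m]!!≡2^m*m! : ∀ m → (2 * m) !! ≡ 2 ^ m * m !
[2m]!!≡2^m*m! zero    = refl
[2m]!!≡2^m*m! (suc m) = begin
  (2 * suc m) !!                 ≡⟨ cong _!! (ℕP.*-suc 2 m) ⟩
  (2 + 2 * m) * (2 * m) !!       ≡⟨ cong ((2 + 2 * m) *_) ([2m]!!≡2^m*m! m) ⟩
  (2 + 2 * m) * (2 ^ m * m !)    ≡⟨ regroup m (2 ^ m) (m !) ⟩
  2 * 2 ^ m * (suc m * m !)      ∎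
  where
  open ≡-Reasoning
  regroup : ∀ m p f → (2 + 2 * m) * (p * f) ≡ 2 * p * (suc m * f)
  regroup = ℕ-Solver.solve-∀

[2m]!≡2^m*m!*[2m∸1]!! : ∀ m → (2 * m) ! ≡ 2 ^ m * m ! * (2 * m ∸ 1) !!
[2m]!≡2^m*m!*[2m∸1]!! m = trans (n!≡n!!*[n∸1]!! (2 * m)) (cong (_* (2 * m ∸ 1) !!) ([2m]!!≡2^m*m! m))

[1+2m]!≡2^m*m!*[1+2m]!! : ∀ m → (1 + 2 * m) ! ≡ 2 ^ m * m ! * (1 + 2 * m) !!
[1+2m]!≡2^m*m!*[1+2m]!! m = begin
  (1 + 2 * m) !                    ≡⟨ n!≡n!!*[n∸1]!! (1 + 2 * m) ⟩
  (1 + 2 * m) !! * (2 * m) !!      ≡⟨ cong ((1 + 2 * m) !! *_) ([2m]!!≡2^m*m! m) ⟩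
  (1 + 2 * m) !! * (2 ^ m * m !)   ≡⟨ ℕP.*-comm ((1 + 2 * m) !!) (2 ^ m * m !) ⟩
  2 ^ m * m ! * (1 + 2 * m) !!     ∎
  where open ≡-Reasoning

[2h]/2≡h : ∀ h → (2 * h) / 2 ≡ h
[2h]/2≡h h = trans (cong (_/ 2) (ℕP.*-comm 2 h)) (m*n/n≡m h 2)

cross-multiply-powers-of-2 : ∀ e e′ p r X Y N W R O → e + r ≡ e′ + p →
  2 ^ e * X * Y * N * (W * (2 ^ r * R * O)) ≡ 2 ^ e′ * (2 ^ p * X * Y) * N * (W * R * O)
cross-multiply-powers-of-2 e e′ p r X Y N W R O e+r≡e′+p = begin
  2 ^ e * X * Y * N * (W * (2 ^ r * R * O))   ≡⟨ gather (2 ^ e) (2 ^ r) X Y N W R O ⟩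
  2 ^ e * 2 ^ r * M                           ≡⟨ cong (_* M) powers ⟩
  2 ^ e′ * 2 ^ p * M                          ≡⟨ spread (2 ^ e′) (2 ^ p) X Y N W R O ⟩
  2 ^ e′ * (2 ^ p * X * Y) * N * (W * R * O)  ∎
  where
  open ≡-Reasoning
  M : ℕ
  M = X * Y * N * (W * R * O)
  powers : 2 ^ e * 2 ^ r ≡ 2 ^ e′ * 2 ^ p
  powers = trans (sym (ℕP.^-distribˡ-+-* 2 e r)) (trans (cong (2 ^_) e+r≡e′+p) (ℕP.^-distribˡ-+-* 2 e′ p))
  gather : ∀ a b X Y N W R O → a * X * Y * N * (W * (b * R * O)) ≡ a * b * (X * Y * N * (W * R * O))
  gather = ℕ-Solver.solve-∀
  spread : ∀ a b X Y N W R O → a * b * (X * Y * N * (W * R * O)) ≡ a * (b * X * Y) * N * (W * R * O)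
  spread = ℕ-Solver.solve-∀

a-numerator : ∀ ℓ t → t ≤ ℓ →
  2 ^ (2 * t) * (ℓ + t) ! * (2 * ℓ + 1) ≡ mvPair 1 ℓ t * ((1 + 2 * t) ! * (ℓ ∸ t) !)
a-numerator ℓ t t≤ℓ with ℕP.m≤n⇒∃[o]m+o≡n t≤ℓ
... | d , refl = sym (begin
  mvPair 1 (t + d) t * ((1 + 2 * t) ! * (t + d ∸ t) !)
    ≡⟨ cong (λ e → mvPair 1 (t + d) t * ((1 + 2 * t) ! * e !)) (ℕP.m+n∸m≡n t d) ⟩
  mvPair 1 (t + d) t * ((1 + 2 * t) ! * d !)
    ≡⟨ mvPair-factorial 1 (t + d) t (2 * t) d refl (twice t d) ⟩
  2 ^ (2 * t) * ((2 * t + d) ! * (suc (2 * t) + 2 * d))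
    ≡⟨ cong₂ (λ u v → 2 ^ (2 * t) * (u ! * v)) (sym (twice t d)) (odd t d) ⟩
  2 ^ (2 * t) * ((t + d + t) ! * (2 * (t + d) + 1))
    ≡⟨ ℕP.*-assoc (2 ^ (2 * t)) ((t + d + t) !) (2 * (t + d) + 1) ⟨
  2 ^ (2 * t) * (t + d + t) ! * (2 * (t + d) + 1) ∎)
  where
  open ≡-Reasoning
  twice : ∀ t d → t + d + t ≡ 2 * t + d
  twice = ℕ-Solver.solve-∀
  odd : ∀ t d → suc (2 * t) + 2 * d ≡ 2 * (t + d) + 1
  odd = ℕ-Solver.solve-∀

a-value : ∀ ℓ t → t ≤ ℓ → a ℓ t ≡ ℕ→ℚ (mvPair 1 ℓ t)
a-value ℓ t t≤ℓ = frac≡ℕ→ℚ {m = mvPair 1 ℓ t} {{(1 + 2 * t) !* (ℓ ∸ t) !≢0}} (a-numerator ℓ t t≤ℓ)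

cHigh-numerator : ∀ ℓ s → suc s ≤ 2 * ℓ + 1 →
  2 ^ (2 * suc s ∸ 1) * (2 * ℓ + suc s) ! * (2 * ℓ + 1)
    ≡ mvPair 2 (2 * ℓ + 1) s * ((2 * suc s) ! * (2 * ℓ + 1 ∸ suc s) !)
cHigh-numerator ℓ s 1+s≤N with ℕP.m≤n⇒∃[o]m+o≡n 1+s≤N
... | d , 1+s+d≡N = sym (begin
  mvPair 2 N s * ((2 * suc s) ! * (N ∸ suc s) !)
    ≡⟨ cong₂ (λ u v → mvPair 2 N s * (u ! * v !)) (ℕP.*-suc 2 s) (m+n≡o⇒o∸m≡n {suc s} {d} 1+s+d≡N) ⟩
  mvPair 2 N s * ((2 + 2 * s) ! * d !)
    ≡⟨ mvPair-factorial 2 N s (suc (2 * s)) d refl N+s≡1+2s+d ⟩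
  P * ((suc (2 * s) + d) ! * (2 + 2 * s + 2 * d))
    ≡⟨ cong₂ (λ u v → P * (u ! * v)) 1+2s+d≡2ℓ+1+s 2+2s+2d≡2N ⟩
  P * ((2 * ℓ + suc s) ! * (2 * N))
    ≡⟨ halve P ((2 * ℓ + suc s) !) N ⟩
  2 * P * (2 * ℓ + suc s) ! * N
    ≡⟨ cong (λ e → 2 ^ e * (2 * ℓ + suc s) ! * N) (cong (_∸ 1) (ℕP.*-suc 2 s)) ⟨
  2 ^ (2 * suc s ∸ 1) * (2 * ℓ + suc s) ! * N ∎)
  where
  open ≡-Reasoning
  N P : ℕ
  N = 2 * ℓ + 1
  P = 2 ^ (2 * s)
  N+s≡1+2s+d : N + s ≡ suc (2 * s) + d
  N+s≡1+2s+d = trans (cong (_+ s) (sym 1+s+d≡N)) (shuffle s d)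
    where
    shuffle : ∀ s d → suc s + d + s ≡ suc (2 * s) + d
    shuffle = ℕ-Solver.solve-∀
  1+2s+d≡2ℓ+1+s : suc (2 * s) + d ≡ 2 * ℓ + suc s
  1+2s+d≡2ℓ+1+s = trans (shuffle₁ s d) (trans (cong (s +_) 1+s+d≡N) (shuffle₂ ℓ s))
    where
    shuffle₁ : ∀ s d → suc (2 * s) + d ≡ s + (suc s + d)
    shuffle₁ = ℕ-Solver.solve-∀
    shuffle₂ : ∀ ℓ s → s + (2 * ℓ + 1) ≡ 2 * ℓ + suc s
    shuffle₂ = ℕ-Solver.solve-∀
  2+2s+2d≡2N : 2 + 2 * s + 2 * d ≡ 2 * N
  2+2s+2d≡2N = trans (double s d) (cong (2 *_) 1+s+d≡N)
    where
    double : ∀ s d → 2 + 2 * s + 2 * d ≡ 2 * (suc s + d)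
    double = ℕ-Solver.solve-∀
  halve : ∀ p f n → p * (f * (2 * n)) ≡ 2 * p * f * n
  halve = ℕ-Solver.solve-∀

cHigh-value : ∀ ℓ s → suc s ≤ 2 * ℓ + 1 → cHigh ℓ (suc s) ≡ ℕ→ℚ (mvPair 2 (2 * ℓ + 1) s)
cHigh-value ℓ s 1+s≤N = frac≡ℕ→ℚ {m = mvPair 2 (2 * ℓ + 1) s} {{(2 * suc s) !* (2 * ℓ + 1 ∸ suc s) !≢0}}
                                  (cHigh-numerator ℓ s 1+s≤N)

module EvenCase (g q : ℕ) where

  open ≡-Reasoning

  h ℓ t p : ℕ
  h = suc g
  ℓ = h + q
  t = 2 * h
  p = ℓ + h

  X Y R O : ℕ
  X = (ℓ + t / 2) !
  Y = (2 * ℓ + t ∸ 1) !!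
  R = (ℓ ∸ t / 2) !
  O = (2 * ℓ ∸ t + 1) !!

  2ℓ+t≡2p : 2 * ℓ + t ≡ 2 * p
  2ℓ+t≡2p = shuffle h q
    where
    shuffle : ∀ h q → 2 * (h + q) + 2 * h ≡ 2 * (h + q + h)
    shuffle = ℕ-Solver.solve-∀

  2ℓ∸t+1≡1+2q : 2 * ℓ ∸ t + 1 ≡ 1 + 2 * q
  2ℓ∸t+1≡1+2q = trans (cong (_+ 1) (m+n≡o⇒o∸m≡n {t} {2 * q} (sym (ℕP.*-distribˡ-+ 2 h q))))
                      (ℕP.+-comm (2 * q) 1)

  [2ℓ+t]!-split : (2 * ℓ + t) ! ≡ 2 ^ p * X * Y
  [2ℓ+t]!-split = begin
    (2 * ℓ + t) !                  ≡⟨ cong _! 2ℓ+t≡2p ⟩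
    (2 * p) !                      ≡⟨ [2m]!≡2^m*m!*[2m∸1]!! p ⟩
    2 ^ p * p ! * (2 * p ∸ 1) !!   ≡⟨ cong₂ (λ u v → 2 ^ p * u ! * (v ∸ 1) !!)
                                            (sym (cong (ℓ +_) ([2h]/2≡h h))) (sym 2ℓ+t≡2p) ⟩
    2 ^ p * X * Y                  ∎

  [2ℓ+1∸t]!-split : (2 * ℓ + 1 ∸ t) ! ≡ 2 ^ q * R * O
  [2ℓ+1∸t]!-split = begin
    (2 * ℓ + 1 ∸ t) !              ≡⟨ cong _! (m+n≡o⇒o∸m≡n {t} {1 + 2 * q} (shuffle h q)) ⟩
    (1 + 2 * q) !                  ≡⟨ [1+2m]!≡2^m*m!*[1+2m]!! q ⟩
    2 ^ q * q ! * (1 + 2 * q) !!   ≡⟨ cong₂ (λ u v → 2 ^ q * u ! * v !!)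
                                            (sym (trans (cong (ℓ ∸_) ([2h]/2≡h h)) (ℕP.m+n∸m≡n h q)))
                                            (sym 2ℓ∸t+1≡1+2q) ⟩
    2 ^ q * R * O                  ∎
    where
    shuffle : ∀ h q → 2 * h + (1 + 2 * q) ≡ 2 * (h + q) + 1
    shuffle = ℕ-Solver.solve-∀

  exponents : 3 * t ∸ 1 + q ≡ 2 * t ∸ 1 + p
  exponents = begin
    3 * t ∸ 1 + q          ≡⟨ cong (λ z → z ∸ 1 + q) (six g) ⟩
    5 + 6 * g + q          ≡⟨ balance g q ⟩
    3 + 4 * g + p          ≡⟨ cong (λ z → z ∸ 1 + p) (four g) ⟨
    2 * t ∸ 1 + p          ∎
    where
    six : ∀ g → 3 * (2 * suc g) ≡ suc (5 + 6 * g)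
    six = ℕ-Solver.solve-∀
    four : ∀ g → 2 * (2 * suc g) ≡ suc (3 + 4 * g)
    four = ℕ-Solver.solve-∀
    balance : ∀ g q → 5 + 6 * g + q ≡ 3 + 4 * g + (suc g + q + suc g)
    balance = ℕ-Solver.solve-∀

  cEven≡cHigh : cEven ℓ t ≡ cHigh ℓ t
  cEven≡cHigh = frac-cong {Nₑ} {Dₑ} {Nₕ} {Dₕ}
    {{m*n≢0 _ _ {{(2 * t) !* (ℓ ∸ t / 2) !≢0}} {{(2 * ℓ ∸ t + 1) !!≢0}}}}
    {{(2 * t) !* (2 * ℓ + 1 ∸ t) !≢0}} (begin
    Nₑ * ((2 * t) ! * (2 * ℓ + 1 ∸ t) !)   ≡⟨ cong (λ z → Nₑ * ((2 * t) ! * z)) [2ℓ+1∸t]!-split ⟩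
    Nₑ * ((2 * t) ! * (2 ^ q * R * O))
      ≡⟨ cross-multiply-powers-of-2 (3 * t ∸ 1) (2 * t ∸ 1) p q X Y (2 * ℓ + 1) ((2 * t) !) R O exponents ⟩
    2 ^ (2 * t ∸ 1) * (2 ^ p * X * Y) * (2 * ℓ + 1) * Dₑ
      ≡⟨ cong (λ z → 2 ^ (2 * t ∸ 1) * z * (2 * ℓ + 1) * Dₑ) [2ℓ+t]!-split ⟨
    Nₕ * Dₑ                                 ∎)
    where
    Nₑ Dₑ Nₕ Dₕ : ℕ
    Nₑ = 2 ^ (3 * t ∸ 1) * X * Y * (2 * ℓ + 1)
    Dₑ = (2 * t) ! * R * O
    Nₕ = 2 ^ (2 * t ∸ 1) * (2 * ℓ + t) ! * (2 * ℓ + 1)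
    Dₕ = (2 * t) ! * (2 * ℓ + 1 ∸ t) !

module OddCase (g q : ℕ) where

  open ≡-Reasoning

  ℓ t p : ℕ
  ℓ = g + q
  t = 1 + 2 * g
  p = ℓ + g

  X Y R O : ℕ
  X = (ℓ + (t ∸ 1) / 2) !
  Y = (2 * ℓ + t) !!
  R = (ℓ ∸ (t ∸ 1) / 2) !
  O = (2 * ℓ ∸ t) !!

  2ℓ+t≡1+2p : 2 * ℓ + t ≡ 1 + 2 * p
  2ℓ+t≡1+2p = shuffle g q
    where
    shuffle : ∀ g q → 2 * (g + q) + (1 + 2 * g) ≡ 1 + 2 * (g + q + g)
    shuffle = ℕ-Solver.solve-∀

  2ℓ∸t≡2q∸1 : 2 * ℓ ∸ t ≡ 2 * q ∸ 1
  2ℓ∸t≡2q∸1 = trans (cong₂ _∸_ (ℕP.*-distribˡ-+ 2 g q) (ℕP.+-comm 1 (2 * g)))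
                    (ℕP.[m+n]∸[m+o]≡n∸o (2 * g) (2 * q) 1)

  [2ℓ+t]!-split : (2 * ℓ + t) ! ≡ 2 ^ p * X * Y
  [2ℓ+t]!-split = begin
    (2 * ℓ + t) !                  ≡⟨ cong _! 2ℓ+t≡1+2p ⟩
    (1 + 2 * p) !                  ≡⟨ [1+2m]!≡2^m*m!*[1+2m]!! p ⟩
    2 ^ p * p ! * (1 + 2 * p) !!   ≡⟨ cong₂ (λ u v → 2 ^ p * u ! * v !!)
                                            (sym (cong (ℓ +_) ([2h]/2≡h g))) (sym 2ℓ+t≡1+2p) ⟩
    2 ^ p * X * Y                  ∎

  [2ℓ+1∸t]!-split : (2 * ℓ + 1 ∸ t) ! ≡ 2 ^ q * R * O
  [2ℓ+1∸t]!-split = begin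
    (2 * ℓ + 1 ∸ t) !              ≡⟨ cong _! (m+n≡o⇒o∸m≡n {t} {2 * q} (shuffle g q)) ⟩
    (2 * q) !                      ≡⟨ [2m]!≡2^m*m!*[2m∸1]!! q ⟩
    2 ^ q * q ! * (2 * q ∸ 1) !!   ≡⟨ cong₂ (λ u v → 2 ^ q * u ! * v !!)
                                            (sym (trans (cong (ℓ ∸_) ([2h]/2≡h g)) (ℕP.m+n∸m≡n g q)))
                                            (sym 2ℓ∸t≡2q∸1) ⟩
    2 ^ q * R * O                  ∎
    where
    shuffle : ∀ g q → 1 + 2 * g + 2 * q ≡ 2 * (g + q) + 1
    shuffle = ℕ-Solver.solve-∀

  exponents : 3 * t ∸ 2 + q ≡ 2 * t ∸ 1 + p
  exponents = begin
    3 * t ∸ 2 + q          ≡⟨ cong (λ z → z ∸ 2 + q) (six g) ⟩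
    1 + 6 * g + q          ≡⟨ balance g q ⟩
    1 + 4 * g + p          ≡⟨ cong (λ z → z ∸ 1 + p) (four g) ⟨
    2 * t ∸ 1 + p          ∎
    where
    six : ∀ g → 3 * (1 + 2 * g) ≡ 2 + (1 + 6 * g)
    six = ℕ-Solver.solve-∀
    four : ∀ g → 2 * (1 + 2 * g) ≡ 1 + (1 + 4 * g)
    four = ℕ-Solver.solve-∀
    balance : ∀ g q → 1 + 6 * g + q ≡ 1 + 4 * g + (g + q + g)
    balance = ℕ-Solver.solve-∀

  cOdd≡cHigh : cOdd ℓ t ≡ cHigh ℓ t
  cOdd≡cHigh = frac-cong {Nₒ} {Dₒ} {Nₕ} {Dₕ}
    {{m*n≢0 _ _ {{(2 * t) !* (ℓ ∸ (t ∸ 1) / 2) !≢0}} {{(2 * ℓ ∸ t) !!≢0}}}}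
    {{(2 * t) !* (2 * ℓ + 1 ∸ t) !≢0}} (begin
    Nₒ * ((2 * t) ! * (2 * ℓ + 1 ∸ t) !)   ≡⟨ cong (λ z → Nₒ * ((2 * t) ! * z)) [2ℓ+1∸t]!-split ⟩
    Nₒ * ((2 * t) ! * (2 ^ q * R * O))
      ≡⟨ cross-multiply-powers-of-2 (3 * t ∸ 2) (2 * t ∸ 1) p q X Y (2 * ℓ + 1) ((2 * t) !) R O exponents ⟩
    2 ^ (2 * t ∸ 1) * (2 ^ p * X * Y) * (2 * ℓ + 1) * Dₒ
      ≡⟨ cong (λ z → 2 ^ (2 * t ∸ 1) * z * (2 * ℓ + 1) * Dₒ) [2ℓ+t]!-split ⟨
    Nₕ * Dₒ                                 ∎)
    where
    Nₒ Dₒ Nₕ Dₕ : ℕ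
    Nₒ = 2 ^ (3 * t ∸ 2) * X * Y * (2 * ℓ + 1)
    Dₒ = (2 * t) ! * R * O
    Nₕ = 2 ^ (2 * t ∸ 1) * (2 * ℓ + t) ! * (2 * ℓ + 1)
    Dₕ = (2 * t) ! * (2 * ℓ + 1 ∸ t) !

even⇒t≡2*[t/2] : ∀ t → (t % 2 ≡ᵇ 0) ≡ true → t ≡ 2 * (t / 2)
even⇒t≡2*[t/2] t even = begin
  t                      ≡⟨ m≡m%n+[m/n]*n t 2 ⟩
  t % 2 + (t / 2) * 2    ≡⟨ cong (_+ (t / 2) * 2) (ℕP.≡ᵇ⇒≡ (t % 2) 0 (Equivalence.from T-≡ even)) ⟩
  (t / 2) * 2            ≡⟨ ℕP.*-comm (t / 2) 2 ⟩
  2 * (t / 2)            ∎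
  where open ≡-Reasoning

odd⇒t≡1+2*[t/2] : ∀ t → (t % 2 ≡ᵇ 0) ≡ false → t ≡ 1 + 2 * (t / 2)
odd⇒t≡1+2*[t/2] t odd = begin
  t                      ≡⟨ m≡m%n+[m/n]*n t 2 ⟩
  t % 2 + (t / 2) * 2    ≡⟨ cong (_+ (t / 2) * 2) (remainder-one (t % 2) (m%n<n t 2) odd) ⟩
  1 + (t / 2) * 2        ≡⟨ cong (1 +_) (ℕP.*-comm (t / 2) 2) ⟩
  1 + 2 * (t / 2)        ∎
  where
  open ≡-Reasoning
  remainder-one : ∀ r → r < 2 → (r ≡ᵇ 0) ≡ false → r ≡ 1
  remainder-one 1 _ _ = refl
  remainder-one 0 _ ()
  remainder-one (suc (suc _)) (s≤s (s≤s ())) _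

cEven≡cHigh : ∀ ℓ t h → 1 ≤ t → t ≤ ℓ → t ≡ 2 * h → cEven ℓ t ≡ cHigh ℓ t
cEven≡cHigh ℓ _ zero    () _ refl
cEven≡cHigh ℓ _ (suc g) _  t≤ℓ refl = subst (λ ℓ → cEven ℓ (2 * suc g) ≡ cHigh ℓ (2 * suc g))
  (ℕP.m+[n∸m]≡n (ℕP.≤-trans (ℕP.m≤m+n (suc g) (suc g + 0)) t≤ℓ)) (EvenCase.cEven≡cHigh g (ℓ ∸ suc g))

cOdd≡cHigh : ∀ ℓ t g → t ≤ ℓ → t ≡ 1 + 2 * g → cOdd ℓ t ≡ cHigh ℓ t
cOdd≡cHigh ℓ _ g t≤ℓ refl = subst (λ ℓ → cOdd ℓ (1 + 2 * g) ≡ cHigh ℓ (1 + 2 * g))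
  (ℕP.m+[n∸m]≡n (ℕP.≤-trans (ℕP.m≤n⇒m≤1+n (ℕP.m≤m+n g (g + 0))) t≤ℓ)) (OddCase.cOdd≡cHigh g (ℓ ∸ g))

if-cases : ∀ {A : Set} b {x y z : A} → (b ≡ true → x ≡ z) → (b ≡ false → y ≡ z) → (if b then x else y) ≡ z
if-cases true  x≡z _   = x≡z refl
if-cases false _   y≡z = y≡z refl

c≡cHigh : ∀ ℓ s → c ℓ (suc s) ≡ cHigh ℓ (suc s)
c≡cHigh ℓ s = if-cases (suc s ≤ᵇ ℓ)
  (λ 1+s≤ℓ → if-cases (suc s % 2 ≡ᵇ 0)
    (λ even → cEven≡cHigh ℓ (suc s) (suc s / 2) (s≤s z≤n) (≤ᵇ⇒≤ 1+s≤ℓ) (even⇒t≡2*[t/2] (suc s) even))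
    (λ odd  → cOdd≡cHigh ℓ (suc s) (suc s / 2) (≤ᵇ⇒≤ 1+s≤ℓ) (odd⇒t≡1+2*[t/2] (suc s) odd)))
  (λ _ → refl)
  where
  ≤ᵇ⇒≤ : (suc s ≤ᵇ ℓ) ≡ true → suc s ≤ ℓ
  ≤ᵇ⇒≤ 1+s≤ℓ = ℕP.≤ᵇ⇒≤ (suc s) ℓ (Equivalence.from T-≡ 1+s≤ℓ)

c-value : ∀ ℓ s → suc s ≤ 2 * ℓ + 1 → c ℓ (suc s) ≡ ℕ→ℚ (mvPair 2 (2 * ℓ + 1) s)
c-value ℓ s 1+s≤2ℓ+1 = trans (c≡cHigh ℓ s) (cHigh-value ℓ s 1+s≤2ℓ+1)

A-poly B-poly Q-poly : ℚ → ℕ → ℚ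
A-poly k n = eval n (mvPair 1 n) k
B-poly k n = eval n (mvCoeff 0 n) k
Q-poly k n = eval n (mvPair 2 n) k

Cpoly≡1+k*Q-poly : ∀ ℓ k → Cpoly ℓ k ≡ 1ℚ +ℚ k *ℚ Q-poly k (1 + 2 * ℓ)
Cpoly≡1+k*Q-poly ℓ k = begin
  sumTo (2 * ℓ + 1) (λ t → c ℓ t *ℚ (k ^ℚ t))
    ≡⟨ cong (λ n → sumTo n (λ t → c ℓ t *ℚ (k ^ℚ t))) (ℕP.+-comm (2 * ℓ) 1) ⟩
  sumTo (1 + 2 * ℓ) (λ t → c ℓ t *ℚ (k ^ℚ t))
    ≡⟨ sumTo-suc (2 * ℓ) (λ t → c ℓ t *ℚ (k ^ℚ t)) ⟩
  1ℚ *ℚ 1ℚ +ℚ sumTo (2 * ℓ) (λ s → c ℓ (suc s) *ℚ (k *ℚ (k ^ℚ s)))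
    ≡⟨ cong₂ _+ℚ_ (QP.*-identityˡ 1ℚ) (sumTo-cong (2 * ℓ) higher-terms) ⟩
  1ℚ +ℚ sumTo (2 * ℓ) (λ s → k *ℚ (ℕ→ℚ (mvPair 2 N s) *ℚ (k ^ℚ s)))
    ≡⟨ cong (1ℚ +ℚ_) (sumTo-*ˡ (2 * ℓ) k (λ s → ℕ→ℚ (mvPair 2 N s) *ℚ (k ^ℚ s))) ⟩
  1ℚ +ℚ k *ℚ eval (2 * ℓ) (mvPair 2 N) k
    ≡⟨ cong (λ e → 1ℚ +ℚ k *ℚ e) (eval-extend 1 (2 * ℓ) (mvPair 2 N) k vanishes) ⟨
  1ℚ +ℚ k *ℚ Q-poly k N ∎
  where
  open ≡-Reasoning
  N : ℕ
  N = 1 + 2 * ℓ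
  higher-terms : ∀ s → s ≤ 2 * ℓ →
                 c ℓ (suc s) *ℚ (k *ℚ (k ^ℚ s)) ≡ k *ℚ (ℕ→ℚ (mvPair 2 N s) *ℚ (k ^ℚ s))
  higher-terms s s≤2ℓ = begin
    c ℓ (suc s) *ℚ (k *ℚ (k ^ℚ s))
      ≡⟨ cong (_*ℚ (k *ℚ (k ^ℚ s)))
              (c-value ℓ s (subst (suc s ≤_) (ℕP.+-comm 1 (2 * ℓ)) (s≤s s≤2ℓ))) ⟩
    ℕ→ℚ (mvPair 2 (2 * ℓ + 1) s) *ℚ (k *ℚ (k ^ℚ s))
      ≡⟨ cong (λ n → ℕ→ℚ (mvPair 2 n s) *ℚ (k *ℚ (k ^ℚ s))) (ℕP.+-comm (2 * ℓ) 1) ⟩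
    ℕ→ℚ (mvPair 2 N s) *ℚ (k *ℚ (k ^ℚ s))
      ≡⟨ ℚ*.x∙yz≈y∙xz (ℕ→ℚ (mvPair 2 N s)) k (k ^ℚ s) ⟩
    k *ℚ (ℕ→ℚ (mvPair 2 N s) *ℚ (k ^ℚ s)) ∎
  vanishes : ∀ t → 2 * ℓ < t → mvPair 2 N t ≡ 0
  vanishes t 2ℓ<t = mvPair-vanishes 2 N t (s≤s (s≤s 2ℓ<t))

module _ (k : ℚ) where

  A-rec : ChebyshevRecurrence (1ℚ +ℚ ℕ→ℚ 2 *ℚ k) 0ℚ (A-poly k)
  A-rec = eval-chebyshev (chebyshev-pair mvCoeff₁-chebyshev)
                         (λ n t n<t → mvPair-vanishes 1 n t (s≤s n<t)) k

  B-rec : ChebyshevRecurrence (1ℚ +ℚ ℕ→ℚ 2 *ℚ k) 0ℚ (B-poly k)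
  B-rec = eval-chebyshev mvCoeff₀-chebyshev (λ n t → mvCoeff-vanishes 0 n t) k

  Q-rec : ChebyshevRecurrence (1ℚ +ℚ ℕ→ℚ 2 *ℚ k) (ℕ→ℚ 2) (Q-poly k)
  Q-rec = eval-chebyshev (chebyshev-pair mvCoeff₂-chebyshev)
                         (λ n t n<t → mvPair-vanishes 2 n t (s≤s (ℕP.m≤n⇒m≤1+n n<t))) k

  A₁ : A-poly k 1 ≡ ℕ→ℚ 2 *ℚ (1ℚ +ℚ ℕ→ℚ 2 *ℚ k) +ℚ 1ℚ
  A₁ = begin
    A-poly k 1                                   ≡⟨⟩
    ℕ→ℚ 3 *ℚ 1ℚ +ℚ ℕ→ℚ 4 *ℚ (k *ℚ 1ℚ)           ≡⟨ solve (k ∷ []) ℚ-ring ⟩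
    ℕ→ℚ 2 *ℚ (1ℚ +ℚ ℕ→ℚ 2 *ℚ k) +ℚ 1ℚ          ∎
    where open ≡-Reasoning

  B₁ : B-poly k 1 ≡ ℕ→ℚ 2 *ℚ (1ℚ +ℚ ℕ→ℚ 2 *ℚ k) -ℚ 1ℚ
  B₁ = begin
    B-poly k 1                                   ≡⟨⟩
    ℕ→ℚ 1 *ℚ 1ℚ +ℚ ℕ→ℚ 4 *ℚ (k *ℚ 1ℚ)           ≡⟨ solve (k ∷ []) ℚ-ring ⟩
    ℕ→ℚ 2 *ℚ (1ℚ +ℚ ℕ→ℚ 2 *ℚ k) -ℚ 1ℚ          ∎
    where open ≡-Reasoning

  Q₁ : Q-poly k 1 ≡ 1ℚ
  Q₁ = begin
    Q-poly k 1                                   ≡⟨⟩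
    ℕ→ℚ 1 *ℚ 1ℚ +ℚ ℕ→ℚ 0 *ℚ (k *ℚ 1ℚ)           ≡⟨ solve (k ∷ []) ℚ-ring ⟩
    1ℚ                                           ∎
    where open ≡-Reasoning

  Q₂ : Q-poly k 2 ≡ ℕ→ℚ 2 *ℚ (1ℚ +ℚ ℕ→ℚ 2 *ℚ k) +ℚ ℕ→ℚ 2
  Q₂ = begin
    Q-poly k 2                                                     ≡⟨⟩
    ℕ→ℚ 4 *ℚ 1ℚ +ℚ ℕ→ℚ 4 *ℚ (k *ℚ 1ℚ) +ℚ ℕ→ℚ 0 *ℚ (k *ℚ (k *ℚ 1ℚ))  ≡⟨ solve (k ∷ []) ℚ-ring ⟩
    ℕ→ℚ 2 *ℚ (1ℚ +ℚ ℕ→ℚ 2 *ℚ k) +ℚ ℕ→ℚ 2                          ∎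
    where open ≡-Reasoning

  open ChebyshevPell (1ℚ +ℚ ℕ→ℚ 2 *ℚ k) (A-poly k) (B-poly k) (Q-poly k)
                     A-rec B-rec Q-rec refl A₁ refl B₁ Q₁ Q₂

  Apoly≡A-poly : ∀ ℓ → Apoly ℓ k ≡ A-poly k ℓ
  Apoly≡A-poly ℓ = sumTo-cong ℓ (λ t t≤ℓ → cong (_*ℚ (k ^ℚ t)) (a-value ℓ t t≤ℓ))

  Cpoly≡k*A²+1 : ∀ ℓ → Cpoly ℓ k ≡ k *ℚ (A-poly k ℓ *ℚ A-poly k ℓ) +ℚ 1ℚ
  Cpoly≡k*A²+1 ℓ = begin
    Cpoly ℓ k                                   ≡⟨ Cpoly≡1+k*Q-poly ℓ k ⟩
    1ℚ +ℚ k *ℚ Q-poly k (1 + 2 * ℓ)             ≡⟨ cong (λ q → 1ℚ +ℚ k *ℚ q) (proj₁ (Q-odd-even ℓ)) ⟩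
    1ℚ +ℚ k *ℚ (A-poly k ℓ *ℚ A-poly k ℓ)       ≡⟨ QP.+-comm 1ℚ (k *ℚ (A-poly k ℓ *ℚ A-poly k ℓ)) ⟩
    k *ℚ (A-poly k ℓ *ℚ A-poly k ℓ) +ℚ 1ℚ       ∎
    where open ≡-Reasoning

  pell-in-k : ∀ ℓ → (k +ℚ 1ℚ) *ℚ (B-poly k ℓ *ℚ B-poly k ℓ) ≡ k *ℚ (A-poly k ℓ *ℚ A-poly k ℓ) +ℚ 1ℚ
  pell-in-k ℓ = halve (A-poly k ℓ) (B-poly k ℓ) (pell ℓ)
    where
    open ≡-Reasoning
    halve : ∀ a b → ((1ℚ +ℚ ℕ→ℚ 2 *ℚ k) +ℚ 1ℚ) *ℚ (b *ℚ b) -ℚ ((1ℚ +ℚ ℕ→ℚ 2 *ℚ k) -ℚ 1ℚ) *ℚ (a *ℚ a) ≡ ℕ→ℚ 2 →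
            (k +ℚ 1ℚ) *ℚ (b *ℚ b) ≡ k *ℚ (a *ℚ a) +ℚ 1ℚ
    halve a b pell₂ = begin
      (k +ℚ 1ℚ) *ℚ (b *ℚ b)
        ≡⟨ solve (k ∷ a ∷ b ∷ []) ℚ-ring ⟩
      ½ *ℚ (((1ℚ +ℚ ℕ→ℚ 2 *ℚ k) +ℚ 1ℚ) *ℚ (b *ℚ b) -ℚ ((1ℚ +ℚ ℕ→ℚ 2 *ℚ k) -ℚ 1ℚ) *ℚ (a *ℚ a)) +ℚ k *ℚ (a *ℚ a)
        ≡⟨ cong (λ z → ½ *ℚ z +ℚ k *ℚ (a *ℚ a)) pell₂ ⟩
      ½ *ℚ ℕ→ℚ 2 +ℚ k *ℚ (a *ℚ a)
        ≡⟨ solve (k ∷ a ∷ []) ℚ-ring ⟩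
      k *ℚ (a *ℚ a) +ℚ 1ℚ ∎

  polynomial-identities : ∀ ℓ → (k *ℚ (Apoly ℓ k *ℚ Apoly ℓ k)) +ℚ 1ℚ ≡ Cpoly ℓ k
                              × (k +ℚ 1ℚ) *ℚ (Bpoly ℓ k *ℚ Bpoly ℓ k) ≡ Cpoly ℓ k
  polynomial-identities ℓ =
    trans (cong (λ p → k *ℚ (p *ℚ p) +ℚ 1ℚ) (Apoly≡A-poly ℓ)) (sym (Cpoly≡k*A²+1 ℓ)) ,
    trans (pell-in-k ℓ) (sym (Cpoly≡k*A²+1 ℓ))

mainTheorem6 : (ℓ : ℕ) → 1 ≤ ℓ →
    ((t : ℕ) → t ≤ ℓ → IsPosInt (a ℓ t))
    × ((t : ℕ) → t ≤ ℓ → IsPosInt (b ℓ t))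
    × ((t : ℕ) → t ≤ 2 * ℓ + 1 → IsPosInt (c ℓ t))
    × ((k : ℚ) → (k *ℚ (Apoly ℓ k *ℚ Apoly ℓ k)) +ℚ 1ℚ ≡ Cpoly ℓ k)
    × ((k : ℚ) → (k +ℚ 1ℚ) *ℚ (Bpoly ℓ k *ℚ Bpoly ℓ k) ≡ Cpoly ℓ k)
mainTheorem6 ℓ _ =
  a-positive , b-positive , c-positive ,
  (λ k → proj₁ (polynomial-identities k ℓ)) , (λ k → proj₂ (polynomial-identities k ℓ))
  where
  a-positive : (t : ℕ) → t ≤ ℓ → IsPosInt (a ℓ t)
  a-positive t t≤ℓ = mvPair 1 ℓ t , mvPair-pos 1 ℓ t (s≤s t≤ℓ) , a-value ℓ t t≤ℓ
  b-positive : (t : ℕ) → t ≤ ℓ → IsPosInt (b ℓ t)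
  b-positive t t≤ℓ = mvCoeff 0 ℓ t , mvCoeff-pos 0 ℓ t t≤ℓ , refl
  c-positive : (t : ℕ) → t ≤ 2 * ℓ + 1 → IsPosInt (c ℓ t)
  c-positive zero    _         = 1 , s≤s z≤n , refl
  c-positive (suc s) 1+s≤2ℓ+1 =
    mvPair 2 (2 * ℓ + 1) s , mvPair-pos 2 (2 * ℓ + 1) s (s≤s 1+s≤2ℓ+1) , c-value ℓ s 1+s≤2ℓ+1
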